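{- Let $r\ge 1$ be an integer, let $\rho\subseteq\{1,\dots,r\}$ and $\sigma=\mathbb{N}$. Let $G$ be a connected graph with type partition $V(G)=V_1\uplus\dots\uplus V_b$ (each $V_i$ consisting of vertices of the same type). If $D$ is a minimal $[\sigma,\rho]$-dominating set of $G$, then for every $1\le i\le b$, either $|V_i\cap D|\le r$ or $|V_i\cap D|=|V_i|$.
   Context: $\mathbb{N}=\{0,1,2,\dots\}$. A set $D\subseteq V(G)$ is a $[\sigma,\rho]$-dominating set if every $v\in D$ has $|N(v)\cap D|\in\sigma$ and every $v\in V(G)\setminus D$ has $|N(v)\cap D|\in\rho$ ($N(v)$ the open neighborhood). Minimal means no proper subset of $D$ is a $[\sigma,\rho]$-dominating set. Two vertices $u,v$ have the same type if $N(v)\setminus\{u\}=N(u)\setminus\{v\}$; a type partition is a partition of $V(G)$ into classes whose vertices all have the same type. -}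

module Defs where

open import Data.Nat using (ℕ; zero; suc; _≤_)
open import Data.Fin using (Fin)
open import Data.Fin.Subset using (Subset; _∈_; _∉_; _∩_; ∣_∣; _⊂_; inside; outside)
open import Data.Bool using (Bool; true; false)
open import Data.Vec using (tabulate)
open import Data.Product using (_×_; Σ; ∃)
open import Relation.Binary.PropositionalEquality using (_≡_; _≢_)
open import Relation.Nullary using (¬_)
open import Data.Fin using (_≟_)
open import Relation.Nullary.Decidable using (does)

record Graph (n : ℕ) : Set where
  field
    adj       : Fin n → Fin n → Bool
    symmetric : ∀ u v → adj u v ≡ adj v u
    irrefl    : ∀ v → adj v v ≡ false
open Graph public

N : ∀ {n} → Graph n → Fin n → Subset n
N G v = tabulate (λ u → if-side (adj G v u))
  where
  if-side : Bool → _
  if-side true  = inside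
  if-side false = outside

data Reachable {n} (G : Graph n) : Fin n → Fin n → Set where
  here : ∀ {v} → Reachable G v v
  step : ∀ {u w v} → adj G u w ≡ true → Reachable G w v → Reachable G u v

Connected : ∀ {n} → Graph n → Set
Connected G = ∀ u v → Reachable G u v

IsSigmaRhoDominating : ∀ {n} → (σ ρ : ℕ → Set) → Graph n → Subset n → Set
IsSigmaRhoDominating σ ρ G D =
  (∀ v → v ∈ D → σ ∣ N G v ∩ D ∣) × (∀ v → v ∉ D → ρ ∣ N G v ∩ D ∣)

IsMinimalSigmaRhoDominating : ∀ {n} → (σ ρ : ℕ → Set) → Graph n → Subset n → Set
IsMinimalSigmaRhoDominating σ ρ G D =
  IsSigmaRhoDominating σ ρ G D × (∀ D' → D' ⊂ D → ¬ IsSigmaRhoDominating σ ρ G D')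

SameType : ∀ {n} → Graph n → Fin n → Fin n → Set
SameType G u v = ∀ w → w ≢ u → w ≢ v → adj G v w ≡ adj G u w

IsTypePartition : ∀ {n b} → Graph n → (Fin n → Fin b) → Set
IsTypePartition G cls = ∀ u v → cls u ≡ cls v → SameType G u v

classOf : ∀ {n b} → (Fin n → Fin b) → Fin b → Subset n
classOf cls i = tabulate (λ v → if-side (does (cls v ≟ i)))
  where
  if-side : Bool → _
  if-side true  = inside
  if-side false = outside

Allℕ : ℕ → Set
Allℕ _ = Data.Unit.⊤
  where import Data.Unit

{-# OPTIONS --safe #-}
-- Suppose |Vᵢ ∩ D| > r. A vertex v ∉ D adjacent to some d ∈ Vᵢ ∩ D is adjacent to all of
-- Vᵢ ∩ D, as these are twins of d, so it would see more than r vertices of D; hence no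
-- vertex of Vᵢ ∩ D has a neighbour outside D. If moreover some x ∈ Vᵢ were outside D,
-- then D - d would still be [ℕ,ρ]-dominating: d now sees exactly what its twin x saw,
-- and nobody else outside D sees d. Minimality thus forces Vᵢ ⊆ D.
module Submission where

open import Defs
open import Data.Nat using (ℕ; _≤_; z≤n)
open import Data.Nat.Properties using (≤-trans; _≤?_)
open import Data.Fin using (Fin; _≟_)
open import Data.Fin.Subset using (Subset; _∩_; ∣_∣; _∈_; _∉_; _⊆_; _─_; _-_; ⁅_⁆; Empty)
open import Data.Fin.Subset.Properties
  using (x∈p∩q⁺; x∈p∩q⁻; p∩q⊆p; p─q⊆p; x∈p∧x≢y⇒x∈p-y; x∈p⇒p-x⊂p; x∈⁅x⁆; ⊆-antisym;
         p⊆q⇒∣p∣≤∣q∣; Empty-unique; ∣⊥∣≡0; nonempty?; _∈?_)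
open import Data.Bool using (true; false)
open import Data.Vec using (_∷_; lookup; here; there)
open import Data.Vec.Properties using (lookup∘tabulate; lookup⇒[]=; []=⇒lookup)
open import Data.Product using (_×_; _,_; proj₂)
open import Data.Sum using (_⊎_; inj₁; inj₂)
open import Data.Unit using (tt)
open import Relation.Nullary using (yes; no)
open import Relation.Nullary.Decidable using (decidable-stable)
open import Relation.Binary.PropositionalEquality

x∈p─q⇒x∉q : ∀ {n} {x : Fin n} {p q} → x ∈ p ─ q → x ∉ q
x∈p─q⇒x∉q {p = _ ∷ _} {q = false ∷ _} here ()
x∈p─q⇒x∉q {p = _ ∷ _} {q = _ ∷ _} (there x∈p─q) (there x∈q) = x∈p─q⇒x∉q x∈p─q x∈q

x∈p-y⇒x≢y : ∀ {n} {x y : Fin n} {p} → x ∈ p - y → x ≢ y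
x∈p-y⇒x≢y {y = y} x∈p-y refl = x∈p─q⇒x∉q x∈p-y (x∈⁅x⁆ y)

p∩[q-y]≡p∩q : ∀ {n} {y : Fin n} {p q} → y ∉ p → p ∩ (q - y) ≡ p ∩ q
p∩[q-y]≡p∩q {y = y} {p} {q} y∉p = ⊆-antisym into back
  where
  into : p ∩ (q - y) ⊆ p ∩ q
  into z∈ with x∈p∩q⁻ p (q - y) z∈
  ... | z∈p , z∈q-y = x∈p∩q⁺ (z∈p , p─q⊆p q ⁅ y ⁆ z∈q-y)
  back : p ∩ q ⊆ p ∩ (q - y)
  back z∈ with x∈p∩q⁻ p q z∈
  ... | z∈p , z∈q = x∈p∩q⁺ (z∈p , x∈p∧x≢y⇒x∈p-y z∈q λ { refl → y∉p z∈p })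

Empty⇒∣p∣≡0 : ∀ {n} {p : Subset n} → Empty p → ∣ p ∣ ≡ 0
Empty⇒∣p∣≡0 {n} empty = trans (cong ∣_∣ (Empty-unique empty)) (∣⊥∣≡0 n)

∈classOf⇒cls≡ : ∀ {n b} (cls : Fin n → Fin b) {i w} → w ∈ classOf cls i → cls w ≡ i
∈classOf⇒cls≡ cls {i} {w} w∈Vᵢ
  with cls w ≟ i | trans (sym (lookup∘tabulate _ w)) ([]=⇒lookup w∈Vᵢ)
... | yes clsw≡i | _ = clsw≡i
... | no _       | ()

module _ {n : ℕ} (G : Graph n) where

  lookup-N : (v w : Fin n) → lookup (N G v) w ≡ adj G v w
  lookup-N v w with adj G v w | trans (sym (lookup∘tabulate _ w)) (refl {x = lookup (N G v) w})
  ... | true  | eq = sym eq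
  ... | false | eq = sym eq

  ∈N⇒adj : ∀ {v w} → w ∈ N G v → adj G v w ≡ true
  ∈N⇒adj {v} {w} w∈Nv = trans (sym (lookup-N v w)) ([]=⇒lookup w∈Nv)

  adj⇒∈N : ∀ {v w} → adj G v w ≡ true → w ∈ N G v
  adj⇒∈N {v} {w} vw = lookup⇒[]= w (N G v) (trans (lookup-N v w) vw)

  ∈N-sym : ∀ {v w} → w ∈ N G v → v ∈ N G w
  ∈N-sym {v} {w} w∈Nv = adj⇒∈N (trans (symmetric G w v) (∈N⇒adj w∈Nv))

  ∈N⇒≢ : ∀ {v w} → w ∈ N G v → w ≢ v
  ∈N⇒≢ {w = w} w∈Nv refl with trans (sym (∈N⇒adj w∈Nv)) (irrefl G w)
  ... | ()

  sameType-sym : ∀ {u v} → SameType G u v → SameType G v u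
  sameType-sym uv w w≢v w≢u = sym (uv w w≢u w≢v)

  sameType-∈N : ∀ {u v w} → SameType G u v → w ≢ u → w ≢ v → w ∈ N G v → w ∈ N G u
  sameType-∈N {w = w} uv w≢u w≢v w∈Nv = adj⇒∈N (trans (sym (uv w w≢u w≢v)) (∈N⇒adj w∈Nv))

  -- v ≢ d by irreflexivity, so the twins u and d agree at v.
  ∈N-sameType : ∀ {u d v} → SameType G u d → d ∈ N G v → v ≢ u → u ∈ N G v
  ∈N-sameType ud d∈Nv v≢u =
    ∈N-sym (sameType-∈N ud v≢u (∈N⇒≢ (∈N-sym d∈Nv)) (∈N-sym d∈Nv))

  module _ {b : ℕ} (cls : Fin n → Fin b) (partition : IsTypePartition G cls) where

    classOf⇒sameType : ∀ {i u v} → u ∈ classOf cls i → v ∈ classOf cls i → SameType G u v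
    classOf⇒sameType u∈Vᵢ v∈Vᵢ =
      partition _ _ (trans (∈classOf⇒cls≡ cls u∈Vᵢ) (sym (∈classOf⇒cls≡ cls v∈Vᵢ)))

    class∩D⊆N∩D : ∀ {i D d v} → d ∈ classOf cls i ∩ D → d ∈ N G v → v ∉ D →
                  classOf cls i ∩ D ⊆ N G v ∩ D
    class∩D⊆N∩D {i} {D} d∈Vᵢ∩D d∈Nv v∉D z∈Vᵢ∩D
      with x∈p∩q⁻ (classOf cls i) D d∈Vᵢ∩D | x∈p∩q⁻ (classOf cls i) D z∈Vᵢ∩D
    ... | d∈Vᵢ , _ | z∈Vᵢ , z∈D =
      x∈p∩q⁺ (∈N-sameType (classOf⇒sameType z∈Vᵢ d∈Vᵢ) d∈Nv (λ { refl → v∉D z∈D }) , z∈D)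

  N∩-twin : ∀ {x d D} → SameType G x d → x ∉ D → d ∉ N G x → N G d ∩ (D - d) ≡ N G x ∩ D
  N∩-twin {x} {d} {D} xd x∉D d∉Nx = ⊆-antisym into back
    where
    into : N G d ∩ (D - d) ⊆ N G x ∩ D
    into z∈ with x∈p∩q⁻ (N G d) (D - d) z∈
    ... | z∈Nd , z∈D-d = x∈p∩q⁺
      (sameType-∈N xd (λ { refl → x∉D z∈D }) (x∈p-y⇒x≢y z∈D-d) z∈Nd , z∈D)
      where z∈D = p─q⊆p D ⁅ d ⁆ z∈D-d
    back : N G x ∩ D ⊆ N G d ∩ (D - d)
    back z∈ with x∈p∩q⁻ (N G x) D z∈
    ... | z∈Nx , z∈D = x∈p∩q⁺
      (sameType-∈N (sameType-sym xd) z≢d (λ { refl → x∉D z∈D }) z∈Nx , x∈p∧x≢y⇒x∈p-y z∈D z≢d)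
      where
      z≢d : _ ≢ d
      z≢d refl = d∉Nx z∈Nx

  -- With no neighbour outside D, d is seen by nobody but itself, and d sees what its twin x saw.
  removeTwin-dominating : ∀ {ρ D x d} → IsSigmaRhoDominating Allℕ ρ G D →
                          SameType G x d → x ∉ D → (∀ v → v ∉ D → d ∉ N G v) →
                          IsSigmaRhoDominating Allℕ ρ G (D - d)
  removeTwin-dominating {ρ} {D} {x} {d} (_ , ρ-dom) xd x∉D isolated = (λ _ _ → tt) , ρ-dom′
    where
    ρ-dom′ : ∀ v → v ∉ D - d → ρ ∣ N G v ∩ (D - d) ∣
    ρ-dom′ v v∉D-d with v ≟ d
    ... | yes refl = subst ρ (cong ∣_∣ (sym (N∩-twin xd x∉D (isolated x x∉D)))) (ρ-dom x x∉D)
    ... | no v≢d   = subst ρ (cong ∣_∣ (sym (p∩[q-y]≡p∩q (isolated v v∉D)))) (ρ-dom v v∉D)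
      where
      v∉D : v ∉ D
      v∉D v∈D = v∉D-d (x∈p∧x≢y⇒x∈p-y v∈D v≢d)

  minimal⇒twin∈D : ∀ {ρ D x d} → IsMinimalSigmaRhoDominating Allℕ ρ G D →
                   SameType G x d → d ∈ D → (∀ v → v ∉ D → d ∉ N G v) → x ∈ D
  minimal⇒twin∈D {ρ} {D} {x} {d} (dom , minimal) xd d∈D isolated =
    decidable-stable (x ∈? D) λ x∉D →
      minimal (D - d) (x∈p⇒p-x⊂p d∈D) (removeTwin-dominating {ρ} dom xd x∉D isolated)

lemma6 : (r : ℕ) → 1 ≤ r → (ρ : ℕ → Set) → (∀ k → ρ k → 1 ≤ k × k ≤ r) →
    {n b : ℕ} (G : Graph n) → Connected G →
    (cls : Fin n → Fin b) → IsTypePartition G cls →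
    (D : Subset n) → IsMinimalSigmaRhoDominating Allℕ ρ G D →
    (i : Fin b) →
    ∣ classOf cls i ∩ D ∣ ≤ r ⊎ ∣ classOf cls i ∩ D ∣ ≡ ∣ classOf cls i ∣
lemma6 r _ ρ ρ≤r G _ cls partition D minD@((_ , ρ-dom) , _) i
  with nonempty? (classOf cls i ∩ D) | ∣ classOf cls i ∩ D ∣ ≤? r
... | no empty         | _         = inj₁ (subst (_≤ r) (sym (Empty⇒∣p∣≡0 empty)) z≤n)
... | yes _            | yes small = inj₁ small
... | yes (d , d∈Vᵢ∩D) | no large  =
  inj₂ (cong ∣_∣ (⊆-antisym (p∩q⊆p Vᵢ D) λ x∈Vᵢ → x∈p∩q⁺ (x∈Vᵢ , x∈D x∈Vᵢ)))
  where
  Vᵢ = classOf cls i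
  isolated : ∀ v → v ∉ D → d ∉ N G v
  isolated v v∉D d∈Nv = large (≤-trans
    (p⊆q⇒∣p∣≤∣q∣ (class∩D⊆N∩D G cls partition d∈Vᵢ∩D d∈Nv v∉D))
    (proj₂ (ρ≤r _ (ρ-dom v v∉D))))
  x∈D : ∀ {x} → x ∈ Vᵢ → x ∈ D
  x∈D x∈Vᵢ with x∈p∩q⁻ Vᵢ D d∈Vᵢ∩D
  ... | d∈Vᵢ , d∈D = minimal⇒twin∈D G {ρ} minD (classOf⇒sameType G cls partition x∈Vᵢ d∈Vᵢ) d∈D isolated
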